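{- The set $\left\{ \frac{\operatorname{avd}(G)}{|V(G)|} : G \text{ is a finite graph with at least one vertex} \right\}$ is dense in $\left[\frac{1}{2}, 1\right]$.
   Context: Graphs are finite and simple. A set $S \subseteq V(G)$ is a dominating set of $G$ if every vertex is in $S$ or adjacent to a vertex of $S$; $\mathcal{D}(G)$ is the collection of dominating sets and $\operatorname{avd}(G) = \frac{1}{|\mathcal{D}(G)|}\sum_{S \in \mathcal{D}(G)} |S|$.
   Formalization: Density in $\left[\frac{1}{2}, 1\right]$ is asserted only at rational points of the interval, with rational tolerances. -}

module Defs where

open import Data.Nat as ℕ using (ℕ; zero; suc)
open import Data.Integer using (+_)
open import Data.Bool using (Bool; true; false; _∧_; _∨_)
open import Data.Fin using (Fin)
open import Data.Fin.Subset using (Subset; ∣_∣)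
open import Data.Vec using (Vec; []; _∷_; lookup)
open import Data.List using (List; []; _∷_; map; filter; length; allFin; _++_)
open import Data.Nat.ListAction using (sum)
open import Data.Bool.ListAction using (all; any)
open import Data.Rational using (ℚ; _/_; _*_; 0ℚ)
open import Relation.Binary.PropositionalEquality using (_≡_)

open import Data.Bool.Properties using () renaming (_≟_ to _≟ᵇ_)

record Graph (n : ℕ) : Set where
  field
    adj    : Fin n → Fin n → Bool
    adjSym : ∀ i j → adj i j ≡ adj j i
    irrefl : ∀ i → adj i i ≡ false
open Graph public

allSubsets : (n : ℕ) → List (Subset n)
allSubsets zero    = [] ∷ []
allSubsets (suc n) = map (true ∷_) (allSubsets n) ++ map (false ∷_) (allSubsets n)

isDominating : ∀ {n} → Graph n → Subset n → Bool
isDominating {n} G S =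
  all (λ v → lookup S v ∨ any (λ u → lookup S u ∧ adj G u v) (allFin n)) (allFin n)

-- the collection 𝒟(G) of dominating sets (each subset listed exactly once)
dominatingSets : ∀ {n} → Graph n → List (Subset n)
dominatingSets {n} G = filter (λ S → isDominating G S ≟ᵇ true) (allSubsets n)

-- a / b as a rational, with the (unused) convention a / 0 = 0
frac : ℕ → ℕ → ℚ
frac a zero    = 0ℚ
frac a (suc b) = (+ a) / suc b

avd : ∀ {n} → Graph n → ℚ
avd G = frac (sum (map ∣_∣ (dominatingSets G))) (length (dominatingSets G))

avdRatio : ∀ {n} → Graph n → ℚ
avdRatio {n} G = avd G * frac 1 n

-- The graph K_{m+1} ∪ k·K₁ (a clique on m + 1 vertices plus k isolated vertices) has
-- C = 2^{m+1} − 1 dominating sets, namely the k isolated vertices together with any nonempty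
-- set of clique vertices; their sizes add up to T with 2T = 2kC + (m + 1)(C + 1). So its
-- average dominating-set size is barely above k + (m + 1)/2, out of N = k + m + 1 vertices.
-- Given p/q with q/2 ≤ p ≤ q, write p = u + α and q = 2u + α and take k = αD, m = 2uD.
-- Then N = qD + 1 and 2(Tq − pCN) = (m + 1)q − αC, whose absolute value is at most Cq;
-- hence |avd/N − p/q| ≤ 1/(2N) < 1/D.

module Submission where

open import Data.Bool using (Bool; true; false; _∧_; _∨_)
open import Data.Bool.Properties using (∨-zeroʳ; ∧-zeroʳ; ∧-identityʳ; ∧-idem) renaming (_≟_ to _≟ᵇ_)
open import Data.Bool.ListAction using (and; or; all; any)
open import Data.Fin using (Fin; zero; suc)
open import Data.Fin.Subset using (Subset) renaming (∣_∣ to ∣_∣ˢ)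
open import Data.Integer as ℤ using (+_; +[1+_]; +0; -[1+_]; _⊖_; +<+)
open import Data.Integer.Properties as ℤ using (pos-*; neg-distribˡ-*; m-n≡m⊖n; ∣⊖∣-≤; ∣m⊖n∣≡∣n⊖m∣; drop‿+≤+)
open import Data.List using (List; []; _∷_; map; filter; length; allFin; _++_)
open import Data.List.Properties using (map-tabulate; map-cong; filter-++; filter-≐; filter-all; filter-none; length-map; length-++; map-++; ++-identityʳ)
open import Data.List.Relation.Unary.All using (universal)
open import Data.Nat as ℕ using (ℕ; zero; suc; _+_; _*_; _^_; _∸_; _⊔_; NonZero; >-nonZero; z<s; s≤s⁻¹)
open import Data.Nat.Coprimality using (Coprime)
open import Data.Nat.ListAction using (sum)
open import Data.Nat.ListAction.Properties using (sum-++)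
open import Data.Nat.Properties as ℕ using (+-identityʳ; +-suc; +-assoc; *-assoc; *-comm; *-identityʳ; *-distribˡ-+; m<m+n; m^n>0; m≤n⇒∃[o]m+o≡n; +-cancelˡ-≤; ≤-total; m≤n⇒∣m-n∣≡n∸m; ∣-∣-comm; m*n≢0; *-distribˡ-∣-∣; ∣m+n-m+o∣≡∣n-o∣; ∣m-n∣≤m⊔n; ⊔-lub; *-monoˡ-≤; ≤-trans; ≤-reflexive; m≤n+m; m≤m+n; m≤n*m; n<1+n; *-monoʳ-<; <-≤-trans)
open import Data.Nat.Tactic.RingSolver using (solve-∀)
open import Algebra.Properties.CommutativeSemigroup ℕ.+-commutativeSemigroup using () renaming (x∙yz≈y∙xz to m+[n+o]≡n+[m+o])
open import Algebra.Properties.CommutativeSemigroup ℕ.*-commutativeSemigroup using () renaming (xy∙z≈xz∙y to m*n*o≡m*o*n)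
open import Data.Product using (Σ; ∃₂; _×_; _,_)
open import Data.Rational as ℚ using (ℚ; mkℚ; _≤_; _<_; _-_; ∣_∣; ½; 1ℚ; 0ℚ; toℚᵘ; *≤*; *<*)
open import Data.Rational.Properties using (↥p/↧p≡p; toℚᵘ-fromℚᵘ; toℚᵘ-injective; toℚᵘ-homo-*; toℚᵘ-homo-+; toℚᵘ-homo‿-; toℚᵘ-homo-∣-∣; toℚᵘ-cancel-<)
open import Data.Rational.Unnormalised as ℚᵘ using (mkℚᵘ; _≃_)
open import Data.Rational.Unnormalised.Properties as ℚᵘ using (≃-trans; *-cong; +-cong; -‿cong; ∣-∣-cong)
open import Data.Sum using (inj₁; inj₂)
open import Data.Vec using ([]; _∷_; lookup)
open import Function using (_∘_; id)
open import Level using (Level)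
open import Relation.Binary.PropositionalEquality
open import Relation.Nullary using (Dec)
open import Relation.Unary using (Pred; Decidable)

open import Defs

private
  variable
    a ℓ : Level
    A B : Set a
    n : ℕ

map-allFin-suc : (f : Fin (suc n) → A) → map f (allFin (suc n)) ≡ f zero ∷ map (f ∘ suc) (allFin n)
map-allFin-suc f = trans (map-tabulate id f) (cong (f zero ∷_) (sym (map-tabulate id (f ∘ suc))))

any-allFin-suc : (f : Fin (suc n) → Bool) → any f (allFin (suc n)) ≡ f zero ∨ any (f ∘ suc) (allFin n)
any-allFin-suc f = cong or (map-allFin-suc f)

all-allFin-suc : (f : Fin (suc n) → Bool) → all f (allFin (suc n)) ≡ f zero ∧ all (f ∘ suc) (allFin n)
all-allFin-suc f = cong and (map-allFin-suc f)

any-cong : {f g : A → Bool} → (∀ x → f x ≡ g x) → ∀ xs → any f xs ≡ any g xs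
any-cong f≗g xs = cong or (map-cong f≗g xs)

all-cong : {f g : A → Bool} → (∀ x → f x ≡ g x) → ∀ xs → all f xs ≡ all g xs
all-cong f≗g xs = cong and (map-cong f≗g xs)

any-const-false : (xs : List A) → any (λ _ → false) xs ≡ false
any-const-false []       = refl
any-const-false (_ ∷ xs) = any-const-false xs

all-const-true : (xs : List A) → all (λ _ → true) xs ≡ true
all-const-true []       = refl
all-const-true (_ ∷ xs) = all-const-true xs

-- `dominatingSets G` is `filter (isTrue? (isDominating G)) (allSubsets n)` by definition.
isTrue? : (f : A → Bool) → Decidable (λ x → f x ≡ true)
isTrue? f x = f x ≟ᵇ true

filter-isTrue?-cong : {f g : A → Bool} → (∀ x → f x ≡ g x) → ∀ xs → filter (isTrue? f) xs ≡ filter (isTrue? g) xs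
filter-isTrue?-cong {f = f} {g} f≗g = filter-≐ (isTrue? f) (isTrue? g) ((λ {x} fx → trans (sym (f≗g x)) fx) , λ {x} gx → trans (f≗g x) gx)

filter-map : {P : Pred B ℓ} (P? : Decidable P) (g : A → B) → ∀ xs → filter P? (map g xs) ≡ map g (filter (P? ∘ g) xs)
filter-map P? g []       = refl
filter-map P? g (x ∷ xs) with Dec.does (P? (g x))
... | true  = cong (g x ∷_) (filter-map P? g xs)
... | false = filter-map P? g xs

-- Graph constructions and their dominating sets

addVertex : Bool → Graph n → Graph (suc n)
addVertex {n} b G = record { adj = adj′ ; adjSym = adjSym′ ; irrefl = irrefl′ }
  where
  adj′ : Fin (suc n) → Fin (suc n) → Bool
  adj′ zero    zero    = false
  adj′ zero    (suc j) = b
  adj′ (suc i) zero    = b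
  adj′ (suc i) (suc j) = adj G i j

  adjSym′ : ∀ i j → adj′ i j ≡ adj′ j i
  adjSym′ zero    zero    = refl
  adjSym′ zero    (suc j) = refl
  adjSym′ (suc i) zero    = refl
  adjSym′ (suc i) (suc j) = adjSym G i j

  irrefl′ : ∀ i → adj′ i i ≡ false
  irrefl′ zero    = refl
  irrefl′ (suc i) = irrefl G i

addIsolated : Graph n → Graph (suc n)
addIsolated = addVertex false

cone : Graph n → Graph (suc n)
cone = addVertex true

complete : ∀ n → Graph n
complete zero    = record { adj = λ () ; adjSym = λ () ; irrefl = λ () }
complete (suc n) = cone (complete n)

cliqueWithIsolated : (k m : ℕ) → Graph (suc (k + m))
cliqueWithIsolated zero    m = complete (suc m)
cliqueWithIsolated (suc k) m = addIsolated (cliqueWithIsolated k m)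

nonempty : Subset n → Bool
nonempty {n} S = any (lookup S) (allFin n)

nonempty-∷ : ∀ x (S : Subset n) → nonempty (x ∷ S) ≡ x ∨ nonempty S
nonempty-∷ x S = any-allFin-suc (lookup (x ∷ S))

isDominating-addVertex : ∀ b (G : Graph n) x S →
  isDominating (addVertex b G) (x ∷ S) ≡
    (x ∨ (x ∧ false) ∨ any (λ u → lookup S u ∧ b) (allFin n)) ∧
    all (λ v → lookup S v ∨ (x ∧ b) ∨ any (λ u → lookup S u ∧ adj G u v) (allFin n)) (allFin n)
isDominating-addVertex {n} b G x S = begin
  isDominating G′ (x ∷ S)
    ≡⟨ all-allFin-suc (λ v → lookup (x ∷ S) v ∨ any (λ u → lookup (x ∷ S) u ∧ adj G′ u v) (allFin (suc n))) ⟩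
  (x ∨ any (λ u → lookup (x ∷ S) u ∧ adj G′ u zero) (allFin (suc n))) ∧
  all (λ v → lookup S v ∨ any (λ u → lookup (x ∷ S) u ∧ adj G′ u (suc v)) (allFin (suc n))) (allFin n)
    ≡⟨ cong₂ _∧_ (cong (x ∨_) (any-allFin-suc (λ u → lookup (x ∷ S) u ∧ adj G′ u zero)))
                 (all-cong (λ v → cong (lookup S v ∨_) (any-allFin-suc (λ u → lookup (x ∷ S) u ∧ adj G′ u (suc v)))) (allFin n)) ⟩
  (x ∨ (x ∧ false) ∨ any (λ u → lookup S u ∧ b) (allFin n)) ∧
  all (λ v → lookup S v ∨ (x ∧ b) ∨ any (λ u → lookup S u ∧ adj G u v) (allFin n)) (allFin n) ∎
  where
  open ≡-Reasoning
  G′ : Graph (suc n)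
  G′ = addVertex b G

isDominating-addIsolated-true : (G : Graph n) (S : Subset n) → isDominating (addIsolated G) (true ∷ S) ≡ isDominating G S
isDominating-addIsolated-true G S = isDominating-addVertex false G true S

isDominating-addIsolated-false : (G : Graph n) (S : Subset n) → isDominating (addIsolated G) (false ∷ S) ≡ false
isDominating-addIsolated-false {n} G S = begin
  isDominating (addIsolated G) (false ∷ S)                     ≡⟨ isDominating-addVertex false G false S ⟩
  any (λ u → lookup S u ∧ false) (allFin n) ∧ isDominating G S ≡⟨ cong (_∧ isDominating G S) (any-cong (λ u → ∧-zeroʳ (lookup S u)) (allFin n)) ⟩
  any (λ _ → false) (allFin n) ∧ isDominating G S              ≡⟨ cong (_∧ isDominating G S) (any-const-false (allFin n)) ⟩
  false                                                        ∎
  where open ≡-Reasoning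

isDominating-cone-true : (G : Graph n) (S : Subset n) → isDominating (cone G) (true ∷ S) ≡ true
isDominating-cone-true {n} G S = begin
  isDominating (cone G) (true ∷ S)       ≡⟨ isDominating-addVertex true G true S ⟩
  all (λ v → lookup S v ∨ true) (allFin n) ≡⟨ all-cong (λ v → ∨-zeroʳ (lookup S v)) (allFin n) ⟩
  all (λ _ → true) (allFin n)             ≡⟨ all-const-true (allFin n) ⟩
  true                                    ∎
  where open ≡-Reasoning

isDominating-cone-false : (G : Graph n) (S : Subset n) → isDominating (cone G) (false ∷ S) ≡ nonempty S ∧ isDominating G S
isDominating-cone-false {n} G S = trans (isDominating-addVertex true G false S)
  (cong (_∧ isDominating G S) (any-cong (λ u → ∧-identityʳ (lookup S u)) (allFin n)))

isDominating-complete : ∀ m (S : Subset (suc m)) → isDominating (complete (suc m)) S ≡ nonempty S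
isDominating-complete zero    (true  ∷ []) = refl
isDominating-complete zero    (false ∷ []) = refl
isDominating-complete (suc m) (true  ∷ S)  = trans (isDominating-cone-true (complete (suc m)) S) (sym (nonempty-∷ true S))
isDominating-complete (suc m) (false ∷ S)  = begin
  isDominating (complete (suc (suc m))) (false ∷ S)  ≡⟨ isDominating-cone-false (complete (suc m)) S ⟩
  nonempty S ∧ isDominating (complete (suc m)) S     ≡⟨ cong (nonempty S ∧_) (isDominating-complete m S) ⟩
  nonempty S ∧ nonempty S                            ≡⟨ ∧-idem (nonempty S) ⟩
  nonempty S                                         ≡⟨ nonempty-∷ false S ⟨
  nonempty (false ∷ S)                               ∎
  where open ≡-Reasoning

-- Counting dominating sets

totalSize : List (Subset n) → ℕ
totalSize Ss = sum (map ∣_∣ˢ Ss)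

totalSize-++ : (Ss Ts : List (Subset n)) → totalSize (Ss ++ Ts) ≡ totalSize Ss + totalSize Ts
totalSize-++ Ss Ts = trans (cong sum (map-++ ∣_∣ˢ Ss Ts)) (sum-++ (map ∣_∣ˢ Ss) (map ∣_∣ˢ Ts))

totalSize-map-true : (Ss : List (Subset n)) → totalSize (map (true ∷_) Ss) ≡ length Ss + totalSize Ss
totalSize-map-true []       = refl
totalSize-map-true (S ∷ Ss) = cong suc (begin
  ∣ S ∣ˢ + totalSize (map (true ∷_) Ss) ≡⟨ cong (_+_ ∣ S ∣ˢ) (totalSize-map-true Ss) ⟩
  ∣ S ∣ˢ + (length Ss + totalSize Ss)   ≡⟨ m+[n+o]≡n+[m+o] ∣ S ∣ˢ (length Ss) (totalSize Ss) ⟩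
  length Ss + (∣ S ∣ˢ + totalSize Ss)   ∎)
  where open ≡-Reasoning

totalSize-map-false : (Ss : List (Subset n)) → totalSize (map (false ∷_) Ss) ≡ totalSize Ss
totalSize-map-false []       = refl
totalSize-map-false (S ∷ Ss) = cong (_+_ ∣ S ∣ˢ) (totalSize-map-false Ss)

-- `allSubsets (suc n)` is `extend₀ (allSubsets n) (allSubsets n)` by definition.
extend₀ : (Ss Ts : List (Subset n)) → List (Subset (suc n))
extend₀ Ss Ts = map (true ∷_) Ss ++ map (false ∷_) Ts

length-extend₀ : (Ss Ts : List (Subset n)) → length (extend₀ Ss Ts) ≡ length Ss + length Ts
length-extend₀ Ss Ts = trans (length-++ (map (true ∷_) Ss)) (cong₂ _+_ (length-map (true ∷_) Ss) (length-map (false ∷_) Ts))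

totalSize-extend₀ : (Ss Ts : List (Subset n)) → totalSize (extend₀ Ss Ts) ≡ length Ss + totalSize Ss + totalSize Ts
totalSize-extend₀ Ss Ts = trans (totalSize-++ (map (true ∷_) Ss) (map (false ∷_) Ts))
  (cong₂ _+_ (totalSize-map-true Ss) (totalSize-map-false Ts))

filter-allSubsets-suc : {P : Pred (Subset (suc n)) ℓ} (P? : Decidable P) →
  filter P? (allSubsets (suc n)) ≡ extend₀ (filter (P? ∘ (true ∷_)) (allSubsets n)) (filter (P? ∘ (false ∷_)) (allSubsets n))
filter-allSubsets-suc {n} P? = trans (filter-++ P? (map (true ∷_) (allSubsets n)) (map (false ∷_) (allSubsets n)))
  (cong₂ _++_ (filter-map P? (true ∷_) (allSubsets n)) (filter-map P? (false ∷_) (allSubsets n)))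

length-allSubsets : ∀ n → length (allSubsets n) ≡ 2 ^ n
length-allSubsets zero    = refl
length-allSubsets (suc n) = begin
  length (extend₀ (allSubsets n) (allSubsets n))  ≡⟨ length-extend₀ (allSubsets n) (allSubsets n) ⟩
  length (allSubsets n) + length (allSubsets n)   ≡⟨ cong (λ l → l + l) (length-allSubsets n) ⟩
  2 ^ n + 2 ^ n                                   ≡⟨ cong (_+_ (2 ^ n)) (+-identityʳ (2 ^ n)) ⟨
  2 ^ suc n                                       ∎
  where open ≡-Reasoning

2*totalSize-allSubsets : ∀ n → 2 * totalSize (allSubsets n) ≡ n * 2 ^ n
2*totalSize-allSubsets zero    = refl
2*totalSize-allSubsets (suc n) = begin
  2 * totalSize (extend₀ (allSubsets n) (allSubsets n))  ≡⟨ cong (2 *_) (totalSize-extend₀ (allSubsets n) (allSubsets n)) ⟩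
  2 * (length (allSubsets n) + t + t)                    ≡⟨ cong (λ l → 2 * (l + t + t)) (length-allSubsets n) ⟩
  2 * (2 ^ n + t + t)                                    ≡⟨ expand (2 ^ n) t ⟩
  2 * 2 ^ n + 2 * (2 * t)                                ≡⟨ cong (λ s → 2 * 2 ^ n + 2 * s) (2*totalSize-allSubsets n) ⟩
  2 * 2 ^ n + 2 * (n * 2 ^ n)                            ≡⟨ collect n (2 ^ n) ⟩
  suc n * 2 ^ suc n                                      ∎
  where
  open ≡-Reasoning
  t : ℕ
  t = totalSize (allSubsets n)
  expand : ∀ p t → 2 * (p + t + t) ≡ 2 * p + 2 * (2 * t)
  expand = solve-∀
  collect : ∀ n p → 2 * p + 2 * (n * p) ≡ suc n * (2 * p)
  collect = solve-∀

dominatingSets-addIsolated : (G : Graph n) → dominatingSets (addIsolated G) ≡ map (true ∷_) (dominatingSets G)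
dominatingSets-addIsolated {n} G = begin
  dominatingSets (addIsolated G)
    ≡⟨ filter-allSubsets-suc (isTrue? (isDominating (addIsolated G))) ⟩
  extend₀ (filter (isTrue? (isDominating (addIsolated G) ∘ (true ∷_))) (allSubsets n))
          (filter (isTrue? (isDominating (addIsolated G) ∘ (false ∷_))) (allSubsets n))
    ≡⟨ cong₂ extend₀
         (filter-isTrue?-cong (isDominating-addIsolated-true G) (allSubsets n))
         (trans (filter-isTrue?-cong (isDominating-addIsolated-false G) (allSubsets n))
                (filter-none (isTrue? (λ _ → false)) (universal (λ _ ()) (allSubsets n)))) ⟩
  map (true ∷_) (dominatingSets G) ++ []
    ≡⟨ ++-identityʳ (map (true ∷_) (dominatingSets G)) ⟩
  map (true ∷_) (dominatingSets G) ∎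
  where open ≡-Reasoning

nonemptySubsets : ∀ n → List (Subset n)
nonemptySubsets n = filter (isTrue? nonempty) (allSubsets n)

nonemptySubsets-suc : ∀ n → nonemptySubsets (suc n) ≡ extend₀ (allSubsets n) (nonemptySubsets n)
nonemptySubsets-suc n = trans (filter-allSubsets-suc (isTrue? nonempty))
  (cong₂ extend₀
    (trans (filter-isTrue?-cong (nonempty-∷ true) (allSubsets n))
           (filter-all (isTrue? (λ _ → true)) (universal (λ _ → refl) (allSubsets n))))
    (filter-isTrue?-cong (nonempty-∷ false) (allSubsets n)))

suc-length-nonemptySubsets : ∀ n → suc (length (nonemptySubsets n)) ≡ 2 ^ n
suc-length-nonemptySubsets zero    = refl
suc-length-nonemptySubsets (suc n) = begin
  suc (length (nonemptySubsets (suc n)))                    ≡⟨ cong (suc ∘ length) (nonemptySubsets-suc n) ⟩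
  suc (length (extend₀ (allSubsets n) (nonemptySubsets n))) ≡⟨ cong suc (length-extend₀ (allSubsets n) (nonemptySubsets n)) ⟩
  suc (length (allSubsets n) + length (nonemptySubsets n))  ≡⟨ +-suc (length (allSubsets n)) (length (nonemptySubsets n)) ⟨
  length (allSubsets n) + suc (length (nonemptySubsets n))  ≡⟨ cong₂ _+_ (length-allSubsets n) (suc-length-nonemptySubsets n) ⟩
  2 ^ n + 2 ^ n                                             ≡⟨ cong (_+_ (2 ^ n)) (+-identityʳ (2 ^ n)) ⟨
  2 ^ suc n                                                 ∎
  where open ≡-Reasoning

totalSize-nonemptySubsets : ∀ n → totalSize (nonemptySubsets n) ≡ totalSize (allSubsets n)
totalSize-nonemptySubsets zero    = refl
totalSize-nonemptySubsets (suc n) = begin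
  totalSize (nonemptySubsets (suc n))                               ≡⟨ cong totalSize (nonemptySubsets-suc n) ⟩
  totalSize (extend₀ (allSubsets n) (nonemptySubsets n))            ≡⟨ totalSize-extend₀ (allSubsets n) (nonemptySubsets n) ⟩
  length (allSubsets n) + t + totalSize (nonemptySubsets n)         ≡⟨ cong (_+_ (length (allSubsets n) + t)) (totalSize-nonemptySubsets n) ⟩
  length (allSubsets n) + t + t                                     ≡⟨ totalSize-extend₀ (allSubsets n) (allSubsets n) ⟨
  totalSize (allSubsets (suc n))                                    ∎
  where
  open ≡-Reasoning
  t : ℕ
  t = totalSize (allSubsets n)

dominatingSets-complete : ∀ m → dominatingSets (complete (suc m)) ≡ nonemptySubsets (suc m)
dominatingSets-complete m = filter-isTrue?-cong (isDominating-complete m) (allSubsets (suc m))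

length-dominatingSets-cliqueWithIsolated : ∀ k m →
  length (dominatingSets (cliqueWithIsolated k m)) ≡ length (nonemptySubsets (suc m))
length-dominatingSets-cliqueWithIsolated zero    m = cong length (dominatingSets-complete m)
length-dominatingSets-cliqueWithIsolated (suc k) m = begin
  length (dominatingSets (addIsolated G))    ≡⟨ cong length (dominatingSets-addIsolated G) ⟩
  length (map (true ∷_) (dominatingSets G))  ≡⟨ length-map (true ∷_) (dominatingSets G) ⟩
  length (dominatingSets G)                  ≡⟨ length-dominatingSets-cliqueWithIsolated k m ⟩
  length (nonemptySubsets (suc m))           ∎
  where
  open ≡-Reasoning
  G : Graph (suc (k + m))
  G = cliqueWithIsolated k m

totalSize-dominatingSets-cliqueWithIsolated : ∀ k m →
  totalSize (dominatingSets (cliqueWithIsolated k m)) ≡ k * length (nonemptySubsets (suc m)) + totalSize (allSubsets (suc m))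
totalSize-dominatingSets-cliqueWithIsolated zero    m =
  trans (cong totalSize (dominatingSets-complete m)) (totalSize-nonemptySubsets (suc m))
totalSize-dominatingSets-cliqueWithIsolated (suc k) m = begin
  totalSize (dominatingSets (addIsolated G))                 ≡⟨ cong totalSize (dominatingSets-addIsolated G) ⟩
  totalSize (map (true ∷_) (dominatingSets G))               ≡⟨ totalSize-map-true (dominatingSets G) ⟩
  length (dominatingSets G) + totalSize (dominatingSets G)   ≡⟨ cong₂ _+_ (length-dominatingSets-cliqueWithIsolated k m)
                                                                          (totalSize-dominatingSets-cliqueWithIsolated k m) ⟩
  L + (k * L + totalSize (allSubsets (suc m)))               ≡⟨ +-assoc L (k * L) _ ⟨
  suc k * L + totalSize (allSubsets (suc m))                 ∎
  where
  open ≡-Reasoning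
  G : Graph (suc (k + m))
  G = cliqueWithIsolated k m
  L : ℕ
  L = length (nonemptySubsets (suc m))

suc-length-dominatingSets-cliqueWithIsolated : ∀ k m → suc (length (dominatingSets (cliqueWithIsolated k m))) ≡ 2 ^ suc m
suc-length-dominatingSets-cliqueWithIsolated k m =
  trans (cong suc (length-dominatingSets-cliqueWithIsolated k m)) (suc-length-nonemptySubsets (suc m))

2*totalSize-dominatingSets-cliqueWithIsolated : ∀ k m → let C = length (dominatingSets (cliqueWithIsolated k m)) in
  2 * totalSize (dominatingSets (cliqueWithIsolated k m)) ≡ 2 * (k * C) + suc m * suc C
2*totalSize-dominatingSets-cliqueWithIsolated k m = begin
  2 * totalSize (dominatingSets (cliqueWithIsolated k m))      ≡⟨ cong (2 *_) (totalSize-dominatingSets-cliqueWithIsolated k m) ⟩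
  2 * (k * L + totalSize (allSubsets (suc m)))                 ≡⟨ *-distribˡ-+ 2 (k * L) _ ⟩
  2 * (k * L) + 2 * totalSize (allSubsets (suc m))             ≡⟨ cong₂ (λ l s → 2 * (k * l) + s) (sym (length-dominatingSets-cliqueWithIsolated k m)) (2*totalSize-allSubsets (suc m)) ⟩
  2 * (k * C) + suc m * 2 ^ suc m                              ≡⟨ cong (λ c → 2 * (k * C) + suc m * c) (suc-length-dominatingSets-cliqueWithIsolated k m) ⟨
  2 * (k * C) + suc m * suc C                                  ∎
  where
  open ≡-Reasoning
  C L : ℕ
  C = length (dominatingSets (cliqueWithIsolated k m))
  L = length (nonemptySubsets (suc m))

n<2^n : ∀ n → n ℕ.< 2 ^ n
n<2^n zero    = z<s
n<2^n (suc n) = begin-strict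
  suc n          ≤⟨ n<2^n n ⟩
  2 ^ n          <⟨ m<m+n (2 ^ n) (m^n>0 2 n) ⟩
  2 ^ n + 2 ^ n  ≡⟨ cong (_+_ (2 ^ n)) (+-identityʳ (2 ^ n)) ⟨
  2 ^ suc n      ∎
  where open ℕ.≤-Reasoning

-- Fractions

∣m⊖n∣≡∣m-n∣ : ∀ m n → ℤ.∣ m ⊖ n ∣ ≡ ℕ.∣ m - n ∣
∣m⊖n∣≡∣m-n∣ m n with ≤-total m n
... | inj₁ m≤n = trans (∣⊖∣-≤ m≤n) (sym (m≤n⇒∣m-n∣≡n∸m m≤n))
... | inj₂ n≤m = begin
  ℤ.∣ m ⊖ n ∣   ≡⟨ ∣m⊖n∣≡∣n⊖m∣ m n ⟩
  ℤ.∣ n ⊖ m ∣   ≡⟨ ∣⊖∣-≤ n≤m ⟩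
  m ∸ n         ≡⟨ m≤n⇒∣m-n∣≡n∸m n≤m ⟨
  ℕ.∣ n - m ∣   ≡⟨ ∣-∣-comm n m ⟩
  ℕ.∣ m - n ∣   ∎
  where open ≡-Reasoning

toℚᵘ-frac : ∀ a b .{{_ : NonZero b}} → toℚᵘ (frac a b) ≃ + a ℚᵘ./ b
toℚᵘ-frac a (suc b) = toℚᵘ-fromℚᵘ (mkℚᵘ (+ a) b)

/-*-/ : ∀ a b c d .{{_ : NonZero b}} .{{_ : NonZero d}} →
  (+ a ℚᵘ./ b) ℚᵘ.* (+ c ℚᵘ./ d) ≡ (+ (a * c) ℚᵘ./ (b * d)) {{m*n≢0 b d}}
/-*-/ a (suc b) c (suc d) = cong (ℚᵘ._/ (suc b * suc d)) (sym (pos-* a c))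

frac-*-frac : ∀ a b c d .{{_ : NonZero b}} .{{_ : NonZero d}} → frac a b ℚ.* frac c d ≡ frac (a * c) (b * d)
frac-*-frac a b@(suc _) c d@(suc _) = toℚᵘ-injective (begin
  toℚᵘ (frac a b ℚ.* frac c d)              ≈⟨ toℚᵘ-homo-* (frac a b) (frac c d) ⟩
  toℚᵘ (frac a b) ℚᵘ.* toℚᵘ (frac c d)      ≈⟨ *-cong (toℚᵘ-frac a b) (toℚᵘ-frac c d) ⟩
  (+ a ℚᵘ./ b) ℚᵘ.* (+ c ℚᵘ./ d)            ≡⟨ /-*-/ a b c d ⟩
  + (a * c) ℚᵘ./ (b * d)                    ≈⟨ toℚᵘ-frac (a * c) (b * d) ⟨
  toℚᵘ (frac (a * c) (b * d))               ∎)
  where open ℚᵘ.≃-Reasoning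

∣m/n-p/q∣<r/s : ∀ m n p q r s .{{_ : NonZero n}} .{{_ : NonZero q}} .{{_ : NonZero s}} →
  ℕ.∣ m * q - p * n ∣ * s ℕ.< r * (n * q) → ℚᵘ.∣ + m ℚᵘ./ n ℚᵘ.- + p ℚᵘ./ q ∣ ℚᵘ.< + r ℚᵘ./ s
∣m/n-p/q∣<r/s m n@(suc _) p q@(suc _) r s@(suc _) bound = ℚᵘ.*<* (begin-strict
  + ℤ.∣ + m ℤ.* + q ℤ.+ ℤ.- (+ p) ℤ.* + n ∣ ℤ.* + s  ≡⟨ cong (λ i → + ℤ.∣ i ∣ ℤ.* + s) numerator ⟩
  + ℤ.∣ (m * q) ⊖ (p * n) ∣ ℤ.* + s                  ≡⟨ cong (λ d → + d ℤ.* + s) (∣m⊖n∣≡∣m-n∣ (m * q) (p * n)) ⟩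
  + ℕ.∣ m * q - p * n ∣ ℤ.* + s                      ≡⟨ pos-* ℕ.∣ m * q - p * n ∣ s ⟨
  + (ℕ.∣ m * q - p * n ∣ * s)                        <⟨ +<+ bound ⟩
  + (r * (n * q))                                    ≡⟨ pos-* r (n * q) ⟩
  + r ℤ.* + (n * q)                                  ∎)
  where
  open ℤ.≤-Reasoning
  numerator : + m ℤ.* + q ℤ.+ ℤ.- (+ p) ℤ.* + n ≡ (m * q) ⊖ (p * n)
  numerator = begin-equality
    + m ℤ.* + q ℤ.+ ℤ.- (+ p) ℤ.* + n   ≡⟨ cong₂ ℤ._+_ (pos-* m q) (neg-distribˡ-* (+ p) (+ n)) ⟨
    + (m * q) ℤ.+ ℤ.- (+ p ℤ.* + n)     ≡⟨ cong (λ i → + (m * q) ℤ.+ ℤ.- i) (pos-* p n) ⟨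
    + (m * q) ℤ.- + (p * n)             ≡⟨ m-n≡m⊖n (m * q) (p * n) ⟩
    (m * q) ⊖ (p * n)                   ∎

∣frac-frac∣<frac : ∀ a b c d e f .{{_ : NonZero b}} .{{_ : NonZero d}} .{{_ : NonZero f}} →
  ℕ.∣ a * d - c * b ∣ * f ℕ.< e * (b * d) → ∣ frac a b - frac c d ∣ < frac e f
∣frac-frac∣<frac a b c d e f bound = toℚᵘ-cancel-< (begin-strict
  toℚᵘ ∣ frac a b - frac c d ∣                      ≃⟨ toℚᵘ-homo-∣-∣ (frac a b - frac c d) ⟩
  ℚᵘ.∣ toℚᵘ (frac a b - frac c d) ∣                 ≃⟨ ∣-∣-cong (toℚᵘ-homo-+ (frac a b) (ℚ.- frac c d)) ⟩
  ℚᵘ.∣ toℚᵘ (frac a b) ℚᵘ.+ toℚᵘ (ℚ.- frac c d) ∣   ≃⟨ ∣-∣-cong (+-cong (toℚᵘ-frac a b) (≃-trans (toℚᵘ-homo‿- (frac c d)) (-‿cong (toℚᵘ-frac c d)))) ⟩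
  ℚᵘ.∣ + a ℚᵘ./ b ℚᵘ.- + c ℚᵘ./ d ∣                 <⟨ ∣m/n-p/q∣<r/s a b c d e f bound ⟩
  + e ℚᵘ./ f                                        ≃⟨ toℚᵘ-frac e f ⟨
  toℚᵘ (frac e f)                                   ∎)
  where open ℚᵘ.≤-Reasoning

avdRatio≡frac : (G : Graph n) .{{_ : NonZero (length (dominatingSets G))}} .{{_ : NonZero n}} →
  avdRatio G ≡ frac (totalSize (dominatingSets G)) (length (dominatingSets G) * n)
avdRatio≡frac {n} G = trans (frac-*-frac T C 1 n) (cong (λ t → frac t (C * n)) (*-identityʳ T))
  where
  T C : ℕ
  T = totalSize (dominatingSets G)
  C = length (dominatingSets G)

p≤q≤2p⇒∃[u,α] : ∀ {p q} → p ℕ.≤ q → q ℕ.≤ 2 * p → ∃₂ λ u α → p ≡ u + α × q ≡ p + u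
p≤q≤2p⇒∃[u,α] {p} p≤q q≤2p with u , refl ← m≤n⇒∃[o]m+o≡n p≤q
  with α , refl ← m≤n⇒∃[o]m+o≡n (+-cancelˡ-≤ p u p (subst (p + u ℕ.≤_) (cong (_+_ p) (+-identityʳ p)) q≤2p))
  = u , α , refl , refl

½≤p/q⇒q≤2p : ∀ {p q-1} .{c : Coprime p (suc q-1)} → ½ ≤ mkℚ (+ p) q-1 c → suc q-1 ℕ.≤ 2 * p
½≤p/q⇒q≤2p {p} {q-1} (*≤* ½≤p/q) =
  drop‿+≤+ (subst₂ ℤ._≤_ (ℤ.*-identityˡ (+ suc q-1)) (trans (sym (pos-* p 2)) (cong +_ (*-comm p 2))) ½≤p/q)

p/q≤1⇒p≤q : ∀ {p q-1} .{c : Coprime p (suc q-1)} → mkℚ (+ p) q-1 c ≤ 1ℚ → p ℕ.≤ suc q-1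
p/q≤1⇒p≤q {p} {q-1} (*≤* p/q≤1) = drop‿+≤+ (subst₂ ℤ._≤_ (ℤ.*-identityʳ (+ p)) (ℤ.*-identityˡ (+ suc q-1)) p/q≤1)

½≤x≤1⇒x≡frac[u+α][u+α+u] : ∀ x → ½ ≤ x → x ≤ 1ℚ →
  ∃₂ λ u α → NonZero (u + α + u) × x ≡ frac (u + α) (u + α + u)
½≤x≤1⇒x≡frac[u+α][u+α+u] (mkℚ -[1+ _ ] _ _) (*≤* ()) _
½≤x≤1⇒x≡frac[u+α][u+α+u] x@(mkℚ (+ p) q-1 _) ½≤x x≤1
  with u , α , refl , q≡ ← p≤q≤2p⇒∃[u,α] (p/q≤1⇒p≤q x≤1) (½≤p/q⇒q≤2p ½≤x)
  = u , α , subst NonZero q≡ _ , trans (sym (↥p/↧p≡p x)) (cong (frac (u + α)) q≡)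

-- The approximating graphs

module Approximant (u α D : ℕ) where

  p q k m N : ℕ
  p = u + α
  q = p + u
  k = α * D
  m = 2 * (u * D)
  N = suc (k + m)

  twice-cross-difference : ∀ C T → 2 * T ≡ 2 * (k * C) + suc m * suc C →
    2 * ℕ.∣ T * q - p * (C * N) ∣ ≡ ℕ.∣ suc m * q - α * C ∣
  twice-cross-difference C T 2T≡ = begin
    2 * ℕ.∣ T * q - p * (C * N) ∣            ≡⟨ *-distribˡ-∣-∣ 2 (T * q) (p * (C * N)) ⟩
    ℕ.∣ 2 * (T * q) - 2 * (p * (C * N)) ∣    ≡⟨ cong₂ ℕ.∣_-_∣ 2Tq≡ 2pCN≡ ⟩
    ℕ.∣ X + suc m * q - X + α * C ∣          ≡⟨ ∣m+n-m+o∣≡∣n-o∣ X (suc m * q) (α * C) ⟩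
    ℕ.∣ suc m * q - α * C ∣                  ∎
    where
    open ≡-Reasoning
    X : ℕ
    X = C * q * suc (2 * (p * D))

    2Tq≡ : 2 * (T * q) ≡ X + suc m * q
    2Tq≡ = begin
      2 * (T * q)                             ≡⟨ *-assoc 2 T q ⟨
      2 * T * q                               ≡⟨ cong (_* q) 2T≡ ⟩
      (2 * (k * C) + suc m * suc C) * q       ≡⟨ expand u α D C ⟩
      X + suc m * q                           ∎
      where
      expand : ∀ u α D C → (2 * (α * D * C) + (1 + 2 * (u * D)) * (1 + C)) * (u + α + u)
                         ≡ C * (u + α + u) * (1 + 2 * ((u + α) * D)) + (1 + 2 * (u * D)) * (u + α + u)
      expand = solve-∀

    2pCN≡ : 2 * (p * (C * N)) ≡ X + α * C
    2pCN≡ = expand u α D C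
      where
      expand : ∀ u α D C → 2 * ((u + α) * (C * (1 + (α * D + 2 * (u * D)))))
                         ≡ C * (u + α + u) * (1 + 2 * ((u + α) * D)) + α * C
      expand = solve-∀

  ∣[m+1]q-αC∣≤Cq : ∀ C → suc m ℕ.≤ C → ℕ.∣ suc m * q - α * C ∣ ℕ.≤ C * q
  ∣[m+1]q-αC∣≤Cq C sm≤C = begin
    ℕ.∣ suc m * q - α * C ∣   ≤⟨ ∣m-n∣≤m⊔n (suc m * q) (α * C) ⟩
    suc m * q ⊔ α * C         ≤⟨ ⊔-lub (*-monoˡ-≤ q sm≤C) (≤-trans (*-monoˡ-≤ C α≤q) (≤-reflexive (*-comm q C))) ⟩
    C * q                     ∎
    where
    open ℕ.≤-Reasoning
    α≤q : α ℕ.≤ q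
    α≤q = ≤-trans (m≤n+m α u) (m≤m+n p u)

  D<N : .{{_ : NonZero q}} → D ℕ.< N
  D<N = begin-strict
    D          ≤⟨ m≤n*m D q ⟩
    q * D      ≡⟨ split u α D ⟩
    k + m      <⟨ n<1+n (k + m) ⟩
    N          ∎
    where
    open ℕ.≤-Reasoning
    split : ∀ u α D → (u + α + u) * D ≡ α * D + 2 * (u * D)
    split = solve-∀

  cross-difference-bound : ∀ C T e .{{_ : NonZero q}} .{{_ : NonZero e}} → suc m ℕ.≤ C → 2 * T ≡ 2 * (k * C) + suc m * suc C →
    ℕ.∣ T * q - p * (C * N) ∣ * D ℕ.< e * (C * N * q)
  cross-difference-bound C T e sm≤C 2T≡ = begin-strict
    ℕ.∣ T * q - p * (C * N) ∣ * D         ≤⟨ m≤n*m _ 2 ⟩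
    2 * (ℕ.∣ T * q - p * (C * N) ∣ * D)   ≡⟨ *-assoc 2 ℕ.∣ T * q - p * (C * N) ∣ D ⟨
    2 * ℕ.∣ T * q - p * (C * N) ∣ * D     ≡⟨ cong (_* D) (twice-cross-difference C T 2T≡) ⟩
    ℕ.∣ suc m * q - α * C ∣ * D           ≤⟨ *-monoˡ-≤ D (∣[m+1]q-αC∣≤Cq C sm≤C) ⟩
    C * q * D                             <⟨ *-monoʳ-< (C * q) {{Cq≢0}} D<N ⟩
    C * q * N                             ≡⟨ m*n*o≡m*o*n C q N ⟩
    C * N * q                             ≤⟨ m≤n*m _ e ⟩
    e * (C * N * q)                       ∎
    where
    open ℕ.≤-Reasoning
    Cq≢0 : NonZero (C * q)
    Cq≢0 = m*n≢0 C q {{>-nonZero (<-≤-trans z<s sm≤C)}}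

  ∣avdRatio-p/q∣<e/D : ∀ e .{{_ : NonZero q}} .{{_ : NonZero D}} .{{_ : NonZero e}} →
    ∣ avdRatio (cliqueWithIsolated k m) - frac p q ∣ < frac e D
  ∣avdRatio-p/q∣<e/D e = subst (λ r → ∣ r - frac p q ∣ < frac e D) (sym (avdRatio≡frac G {{C≢0}}))
    (∣frac-frac∣<frac T (C * N) p q e D {{m*n≢0 C N {{C≢0}}}}
      (cross-difference-bound C T e sm≤C (2*totalSize-dominatingSets-cliqueWithIsolated k m)))
    where
    G : Graph N
    G = cliqueWithIsolated k m
    C T : ℕ
    C = length (dominatingSets G)
    T = totalSize (dominatingSets G)
    sm≤C : suc m ℕ.≤ C
    sm≤C = s≤s⁻¹ (subst (suc m ℕ.<_) (sym (suc-length-dominatingSets-cliqueWithIsolated k m)) (n<2^n (suc m)))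
    C≢0 : NonZero C
    C≢0 = >-nonZero (<-≤-trans z<s sm≤C)

proposition4p4 : (x ε : ℚ) → ½ ≤ x → x ≤ 1ℚ → 0ℚ < ε →
    Σ ℕ (λ n → Σ (Graph (suc n)) (λ G → ∣ avdRatio G - x ∣ < ε))
proposition4p4 _ (mkℚ +0 _ _)       _ _ (*<* (+<+ ()))
proposition4p4 _ (mkℚ -[1+ _ ] _ _) _ _ (*<* ())
proposition4p4 x ε@(mkℚ +[1+ e ] D-1 _) ½≤x x≤1 _
  with u , α , q≢0 , x≡ ← ½≤x≤1⇒x≡frac[u+α][u+α+u] x ½≤x x≤1
  = k + m , cliqueWithIsolated k m ,
    subst₂ (λ y δ → ∣ avdRatio (cliqueWithIsolated k m) - y ∣ < δ) (sym x≡) (↥p/↧p≡p ε) (∣avdRatio-p/q∣<e/D (suc e) {{q≢0}})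
  where open Approximant u α (suc D-1)
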